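{- Let $k\ge2$, let $\mathcal{P}$ be a $(k-1)$-partition with $\mathcal{P}^{(1)}\prec\{V^1,\dots,V^k\}$, and let $F\in E_k(\mathcal{P})$ and $V\in V_k(\mathcal{P})$. Then there is a set of $k$-polyads $\{P_i\}_i$ of $\mathcal{P}$ such that $F\circ V=\bigcup_i\mathcal{K}(P_i)$, this union being a partition, where each $P_i=(P_{i,1},\dots,P_{i,k-1},F)$.
   Context: $V^1,\dots,V^k$ are disjoint finite sets. A $k$-graph is $(V,E)$, $E\subseteq\binom{V}{k}$; $\ell$-partite on $(V_1,\dots,V_\ell)$ if each edge meets each class in at most one vertex. $\mathrm{Cross}_r(\mathcal{Z})$: $r$-sets meeting each part of $\mathcal{Z}$ in at most one vertex. A $k$-polyad is a $k$-partite $(k-1)$-graph $P$ on $(W_1,\dots,W_k)$, identified with $(F_1,\dots,F_k)$ where $F_i$ is the induced subhypergraph on $\bigcup_{j\ne i}W_j$ (1-graphs are identified with vertex sets; a 2-polyad is a pair of disjoint vertex sets); $\mathcal{K}(P)$ is the $k$-graph of $k$-sets all of whose $(k-1)$-subsets are edges of $P$; $P$ is a polyad of $\mathcal{P}$ if every $F_i\in\mathcal{P}$. A $k$-partition on $V$ is $\mathcal{P}^{(1)}\cup\dots\cup\mathcal{P}^{(k)}$ where $\mathcal{P}^{(1)}$ is a partition of $V$ and for $2\le r\le k$, $\mathcal{P}^{(r)}$ is a partition of $\mathrm{Cross}_r(\mathcal{P}^{(1)})$ into $r$-partite $r$-graphs such that each member is contained in $\mathcal{K}(P)$ for an $r$-polyad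 $P$ of $\mathcal{P}$. $V_k(\mathcal{P})=\{Z\in\mathcal{P}^{(1)}:Z\subseteq V^k\}$ and $E_k(\mathcal{P})=\{E\in\mathcal{P}^{(k-1)}:E\subseteq V^1\times\dots\times V^{k-1}\}$ (for $k=2$, $\mathcal{P}^{(1)}$ parts inside $V^1$). For a $(k-1)$-partite $(k-1)$-graph $F$ on $(V_1,\dots,V_{k-1})$ and a disjoint vertex set $V$, $F\circ V=\{(v_1,\dots,v_k):(v_1,\dots,v_{k-1})\in F,\,v_k\in V\}$, viewed as a $k$-partite $k$-graph. -}

module Defs where

open import Level using (0ℓ)
open import Data.Nat using (ℕ; _≤_; _<_; _∸_)
open import Data.Fin using (Fin; toℕ)
open import Data.Fin.Subset using (Subset; ∣_∣; ⁅_⁆; _∪_; _-_) renaming (_∈_ to _∈ₛ_)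
open import Data.Product using (Σ; ∃; _×_; _,_)
open import Relation.Unary using (Pred; _⊆_; Satisfiable; _∈_)
open import Relation.Nullary using (¬_)
open import Relation.Binary.PropositionalEquality using (_≡_; _≢_)
open import Function.Bundles using (_⇔_)

-- Vertices are Fin n.  An r-set is a  s : Subset n  with ∣ s ∣ ≡ r; an r-graph is a
-- predicate on subsets.  1-graphs (sets of singletons) are identified with vertex sets.

record IsPartition {X : Set} (A : Pred X 0ℓ) (m : ℕ) (part : Fin m → Pred X 0ℓ) : Set where
  field
    parts⊆   : ∀ j → part j ⊆ A
    nonempty : ∀ j → Satisfiable (part j)
    cover    : ∀ x → x ∈ A → Σ (Fin m) λ j → x ∈ part j
    disjoint : ∀ {x} i j → x ∈ part i → x ∈ part j → i ≡ j

-- Raw data of a (multi-level) partition: for each level r, m r parts, each an r-graph.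
-- Level 1 (P^(1)) consists of 1-graphs, i.e. vertex sets.  Levels above the intended
-- height are ignored.
record PData (n : ℕ) : Set₁ where
  field
    m    : ℕ → ℕ
    part : (r : ℕ) → Fin (m r) → Pred (Subset n) 0ℓ
open PData public

module _ {n : ℕ} (P : PData n) where

  InPart : Fin (m P 1) → Fin n → Set
  InPart j v = ⁅ v ⁆ ∈ part P 1 j

  MeetsOnce : Fin (m P 1) → Subset n → Set
  MeetsOnce j s = Σ (Fin n) λ v → v ∈ₛ s × InPart j v × (∀ u → u ∈ₛ s → InPart j u → u ≡ v)

  Cross : ℕ → Pred (Subset n) 0ℓ
  Cross r s = ∣ s ∣ ≡ r × (∀ j u v → u ∈ₛ s → v ∈ₛ s → InPart j u → InPart j v → u ≡ v)

  -- An r-polyad of P (r ≥ 2): vertex classes W 1..W r (distinct parts of P^(1)) and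
  -- (r-1)-graphs F 1..F r from P^(r-1), F i being on the classes (W j)_{j ≠ i}.
  -- (For r = 2 the F i are forced to be the vertex classes W of the other index.)
  record Polyad (r : ℕ) : Set where
    field
      W     : Fin r → Fin (m P 1)
      W-inj : ∀ i j → W i ≡ W j → i ≡ j
      F     : Fin r → Fin (m P (r ∸ 1))
      F-on  : ∀ i e → e ∈ part P (r ∸ 1) (F i) →
                (∀ j → j ≢ i → MeetsOnce (W j) e) × (∀ v → v ∈ₛ e → ¬ InPart (W i) v)
  open Polyad public

  𝒦 : ∀ {r} → Polyad r → Pred (Subset n) 0ℓ
  𝒦 {r} Q s = ∣ s ∣ ≡ r × (∀ j → MeetsOnce (W Q j) s)
              × (∀ i v → v ∈ₛ s → InPart (W Q i) v → (s - v) ∈ part P (r ∸ 1) (F Q i))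

  record IsKPartition (K : ℕ) : Set where
    field
      level1 : IsPartition (λ s → ∣ s ∣ ≡ 1) (m P 1) (part P 1)
      levelr : ∀ r → 2 ≤ r → r ≤ K →
                 IsPartition (Cross r) (m P r) (part P r)
                 × (∀ j → Σ (Polyad r) λ Q → part P r j ⊆ 𝒦 Q)

  -- P^(1) ≺ {V^1,…,V^k}, where V^i = col⁻¹(i)
  Refines : ∀ {k} → (Fin n → Fin k) → Set
  Refines col = ∀ j u v → InPart j u → InPart j v → col u ≡ col v

  Comp : (k : ℕ) → Fin (m P (k ∸ 1)) → Fin (m P 1) → Pred (Subset n) 0ℓ
  Comp k f w s = Σ (Subset n) λ e → Σ (Fin n) λ v →
                   e ∈ part P (k ∸ 1) f × InPart w v × s ≡ e ∪ ⁅ v ⁆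

module Submission where

-- Write k = K + 1.  An element of F∘V is s = e ∪ {v} with e ∈ F and v ∈ V.  The hypotheses
-- say that e has exactly one vertex of each colour 0,…,K-1 and that V has colour K, so s is a
-- *rainbow* k-set: it has exactly one vertex x(i) of each colour i.
--
-- Every rainbow k-set s carries a k-polyad Q(s) of 𝒫: its i-th class is the vertex class of
-- x(i) and its i-th face the part of 𝒫^(K) containing s - x(i); s ∈ 𝒦(Q(s)), and for
-- s ∈ F∘V the last class of Q(s) is V and its last face is F, whence 𝒦(Q(s)) ⊆ F∘V.
-- Conversely, a polyad whose i-th class has colour i is determined (classes and faces, its
-- "shape") by any single k-set of 𝒦, so two such polyads are either equal in shape or have
-- disjoint 𝒦's.  The required family is therefore {Q(s) : s ∈ F∘V} taken up to shape; to
-- index it by Fin N we list F∘V (a decidable family of subsets of a finite set) and keep one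
-- representative per shape.

open import Defs
open import Level using (0ℓ)
open import Data.Nat using (ℕ; zero; suc; _≤_; _<_; _∸_; z≤n; s≤s) renaming (_≟_ to _≟ℕ_)
open import Data.Nat.Properties using (suc-injective; ≤-antisym; ≮⇒≥; ≤-pred; <-irrefl; ≤-refl; _<?_)
open import Data.Fin using (Fin; zero; suc; toℕ; inject₁; fromℕ) renaming (_≟_ to _≟F_)
open import Data.Fin.Properties using (toℕ-injective; inject₁-injective; inject₁ℕ<; toℕ<n; toℕ-fromℕ; 0≢1+n; any?; all?)
open import Data.Fin.Subset using (Subset; ∣_∣; ⁅_⁆; _∪_; _-_; ⊥; inside; outside; Nonempty; Empty)
  renaming (_∈_ to _∈ₛ_; _∉_ to _∉ₛ_)
open import Data.Fin.Subset.Properties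
  using (x∈⁅x⁆; ∣⁅x⁆∣≡1; ∣⊥∣≡0; p─⊥≡p; p─q⊆p; x∈p∧x≢y⇒x∈p-y; x∈p∪q⁺; ∪-identityˡ; ∪-identityʳ; nonempty?; Empty-unique; _∈?_)
open import Data.Vec using ([]; _∷_; here; there)
open import Data.List using (List; []; _∷_; _++_; map; length; lookup; deduplicate)
open import Data.List.Membership.Propositional using () renaming (_∈_ to _∈ₗ_)
open import Data.List.Membership.Propositional.Properties using (∈-map⁺; ∈-++⁺ˡ; ∈-++⁺ʳ; ∈-lookup)
import Data.List.Relation.Unary.Any as Any
import Data.List.Relation.Unary.Any.Properties as AnyProp
import Data.List.Relation.Unary.All as All
open import Data.List.Relation.Unary.AllPairs using (_∷_)
import Data.List.Relation.Unary.Unique.DecSetoid as UniqueDec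
open import Data.List.Relation.Unary.Unique.DecSetoid.Properties using (deduplicate-!)
open import Data.Product using (Σ; ∃; _×_; _,_; proj₁; proj₂)
open import Data.Product.Properties using (≡-dec)
open import Data.Sum using (inj₁; inj₂)
import Data.Vec.Functional.Relation.Binary.Pointwise.Properties as Pointwise
open import Function using (_∘_)
open import Function.Bundles using (_⇔_; mk⇔)
open import Relation.Binary.Bundles using (DecSetoid)
import Relation.Binary.Construct.On as On
open import Relation.Binary.PropositionalEquality using (_≡_; _≢_; refl; sym; trans; cong; cong₂; subst; module ≡-Reasoning)
open import Relation.Binary.PropositionalEquality.Properties using () renaming (decSetoid to ≡-decSetoid)
open import Relation.Nullary using (¬_; yes; no; Dec; contradiction)
open import Relation.Nullary.Decidable using (_×-dec_; _→-dec_; map′)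
open import Relation.Unary using (Pred; _⊆_; _∈_; Satisfiable; Decidable)

open IsPartition

injective-via : ∀ {I A B : Set} (h : A → B) (g : I → A) (c : I → B) →
                (∀ i → h (g i) ≡ c i) → (∀ i j → c i ≡ c j → i ≡ j) →
                ∀ i j → g i ≡ g j → i ≡ j
injective-via h g c hg≡c c-inj i j gi≡gj =
  c-inj i j (trans (sym (hg≡c i)) (trans (cong h gi≡gj) (hg≡c j)))

x∉p-x : ∀ {n} (p : Subset n) (x : Fin n) → x ∉ₛ p - x
x∉p-x (_ ∷ p) zero ()
x∉p-x (_ ∷ p) (suc x) (there h) = x∉p-x p x h

∈-remove⁻ : ∀ {n} {p : Subset n} {x y : Fin n} → y ∈ₛ p - x → y ∈ₛ p × y ≢ x
∈-remove⁻ {p = p} {x} h = p─q⊆p p ⁅ x ⁆ h , λ { refl → x∉p-x p x h }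

size-remove : ∀ {n} (p : Subset n) (x : Fin n) → x ∈ₛ p → ∣ p ∣ ≡ suc ∣ p - x ∣
size-remove (inside ∷ p) zero here = cong (suc ∘ ∣_∣) (sym (p─⊥≡p p))
size-remove (inside ∷ p) (suc x) (there h) = cong suc (size-remove p x h)
size-remove (outside ∷ p) (suc x) (there h) = size-remove p x h

remove-add : ∀ {n} (p : Subset n) (x : Fin n) → x ∈ₛ p → (p - x) ∪ ⁅ x ⁆ ≡ p
remove-add (inside ∷ p) zero here = cong (inside ∷_) (trans (∪-identityʳ _) (p─⊥≡p p))
remove-add (inside ∷ p) (suc x) (there h) = cong (inside ∷_) (remove-add p x h)
remove-add (outside ∷ p) (suc x) (there h) = cong (outside ∷_) (remove-add p x h)

add-remove : ∀ {n} (p : Subset n) (x : Fin n) → x ∉ₛ p → (p ∪ ⁅ x ⁆) - x ≡ p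
add-remove (inside ∷ p) zero x∉p = contradiction here x∉p
add-remove (outside ∷ p) zero _ = cong (outside ∷_) (trans (p─⊥≡p _) (∪-identityʳ p))
add-remove (inside ∷ p) (suc x) x∉p = cong (inside ∷_) (add-remove p x (x∉p ∘ there))
add-remove (outside ∷ p) (suc x) x∉p = cong (outside ∷_) (add-remove p x (x∉p ∘ there))

exhaust : ∀ {n} r (s : Subset n) (g : Fin r → Fin n) → (∀ a b → g a ≡ g b → a ≡ b) →
          (∀ a → g a ∈ₛ s) → ∣ s ∣ ≡ r → ∀ x → x ∈ₛ s → Σ (Fin r) λ a → x ≡ g a
exhaust zero s g g-inj g∈s size x x∈s with trans (sym size) (size-remove s x x∈s)
... | ()
exhaust (suc r) s g g-inj g∈s size x x∈s with x ≟F g zero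
... | yes x≡g0 = zero , x≡g0
... | no x≢g0 =
  let (a , x≡ga) = exhaust r (s - g zero) (g ∘ suc) (λ a b e → Data.Fin.Properties.suc-injective (g-inj _ _ e))
                     (λ a → x∈p∧x≢y⇒x∈p-y (g∈s (suc a)) (λ e → 0≢1+n (sym (g-inj _ _ e))))
                     (suc-injective (trans (sym (size-remove s (g zero) (g∈s zero))) size))
                     x (x∈p∧x≢y⇒x∈p-y x∈s x≢g0)
  in suc a , x≡ga

size-one-unique : ∀ {n} {p : Subset n} {u v : Fin n} → ∣ p ∣ ≡ 1 → u ∈ₛ p → v ∈ₛ p → u ≡ v
size-one-unique {p = p} {u} {v} size u∈p v∈p =
  proj₂ (exhaust 1 p (λ _ → v) (λ { zero zero _ → refl }) (λ _ → v∈p) size u u∈p)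

size-one-singleton : ∀ {n} {p : Subset n} {v : Fin n} → ∣ p ∣ ≡ 1 → v ∈ₛ p → p ≡ ⁅ v ⁆
size-one-singleton {p = p} {v} size v∈p = begin
  p                 ≡⟨ sym (remove-add p v v∈p) ⟩
  (p - v) ∪ ⁅ v ⁆   ≡⟨ cong (_∪ ⁅ v ⁆) (Empty-unique p-v-empty) ⟩
  ⊥ ∪ ⁅ v ⁆         ≡⟨ ∪-identityˡ ⁅ v ⁆ ⟩
  ⁅ v ⁆             ∎
  where
  open ≡-Reasoning
  p-v-empty : Empty (p - v)
  p-v-empty (u , u∈p-v) = let (u∈p , u≢v) = ∈-remove⁻ u∈p-v in u≢v (size-one-unique size u∈p v∈p)

size-pos-nonempty : ∀ {n} (p : Subset n) {r} → ∣ p ∣ ≡ suc r → Nonempty p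
size-pos-nonempty {n} p size with nonempty? p
... | yes ne = ne
... | no ¬ne with trans (sym size) (trans (cong ∣_∣ (Empty-unique ¬ne)) (∣⊥∣≡0 n))
... | ()

witnesses : ∀ {n} {C : Pred (Subset n) 0ℓ} → Decidable C →
            Σ (List (Σ (Subset n) C)) λ L → ∀ s → C s → Σ (C s) λ c → (s , c) ∈ₗ L
witnesses {zero} C? with C? []
... | yes c = (([] , c) ∷ []) , λ { [] _ → c , Any.here refl }
... | no ¬c = [] , λ { [] c → contradiction c ¬c }
witnesses {suc n} {C} C? = map (extend inside) (list inside) ++ map (extend outside) (list outside) , complete
  where
  extend : ∀ b → Σ (Subset n) (λ s → C (b ∷ s)) → Σ (Subset (suc n)) C
  extend b (s , c) = b ∷ s , c
  headed : ∀ b → Σ (List (Σ (Subset n) (λ s → C (b ∷ s)))) λ L → ∀ s → C (b ∷ s) → Σ (C (b ∷ s)) λ c → (s , c) ∈ₗ L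
  headed b = witnesses (λ s → C? (b ∷ s))
  list : ∀ b → List (Σ (Subset n) (λ s → C (b ∷ s)))
  list b = proj₁ (headed b)
  complete : ∀ s → C s → Σ (C s) λ c → (s , c) ∈ₗ map (extend inside) (list inside) ++ map (extend outside) (list outside)
  complete (inside ∷ s) c =
    let (c′ , c′∈) = proj₂ (headed inside) s c in c′ , ∈-++⁺ˡ (∈-map⁺ (extend inside) c′∈)
  complete (outside ∷ s) c =
    let (c′ , c′∈) = proj₂ (headed outside) s c in c′ , ∈-++⁺ʳ _ (∈-map⁺ (extend outside) c′∈)

module Representatives (D : DecSetoid 0ℓ 0ℓ) where
  open DecSetoid D using (Carrier; _≈_; _≟_; reflexive) renaming (sym to ≈-sym; trans to ≈-trans)
  open UniqueDec D using (Unique)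

  lookup-injective : ∀ {xs} → Unique xs → ∀ a b → lookup xs a ≈ lookup xs b → a ≡ b
  lookup-injective (_ ∷ _) zero zero _ = refl
  lookup-injective (x≉ ∷ _) zero (suc b) x≈ = contradiction x≈ (All.lookup x≉ (∈-lookup b))
  lookup-injective (x≉ ∷ _) (suc a) zero x≈ = contradiction (≈-sym x≈) (All.lookup x≉ (∈-lookup a))
  lookup-injective (_ ∷ u) (suc a) (suc b) x≈ = cong suc (lookup-injective u a b x≈)

  representatives : (L : List Carrier) → Σ ℕ λ N → Σ (Fin N → Carrier) λ rep →
                    (∀ {x} → x ∈ₗ L → Σ (Fin N) λ a → x ≈ rep a) × (∀ a b → rep a ≈ rep b → a ≡ b)
  representatives L = length L′ , lookup L′ , represented , lookup-injective (deduplicate-! D L)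
    where
    L′ : List Carrier
    L′ = deduplicate _≟_ L
    represented : ∀ {x} → x ∈ₗ L → Σ (Fin (length L′)) λ a → x ≈ lookup L′ a
    represented x∈L =
      let x≈∈L′ = AnyProp.deduplicate⁺ _≟_ (λ z≈y x≈y → ≈-trans x≈y (≈-sym z≈y)) (Any.map reflexive x∈L)
      in Any.index x≈∈L′ , AnyProp.lookup-index x≈∈L′

part? : ∀ {X : Set} {A : Pred X 0ℓ} {m} {part : Fin m → Pred X 0ℓ} →
        IsPartition A m part → Decidable A → ∀ j → Decidable (part j)
part? Π A? j x with A? x
... | no x∉A = no (x∉A ∘ parts⊆ Π j)
... | yes x∈A with cover Π x x∈A
...   | j′ , x∈j′ with j ≟F j′
...     | yes refl = yes x∈j′
...     | no j≢j′ = no λ x∈j → j≢j′ (disjoint Π j j′ x∈j x∈j′)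

module Classes {n : ℕ} (P : PData n) (L1 : IsPartition (λ s → ∣ s ∣ ≡ 1) (m P 1) (part P 1)) where

  classOf : Fin n → Fin (m P 1)
  classOf u = proj₁ (cover L1 ⁅ u ⁆ (∣⁅x⁆∣≡1 u))

  inClassOf : ∀ u → InPart P (classOf u) u
  inClassOf u = proj₂ (cover L1 ⁅ u ⁆ (∣⁅x⁆∣≡1 u))

  classOf-unique : ∀ {j u} → InPart P j u → classOf u ≡ j
  classOf-unique {j} {u} u∈j = disjoint L1 (classOf u) j (inClassOf u) u∈j

  inPart? : ∀ j u → Dec (InPart P j u)
  inPart? j u = map′ (λ { refl → inClassOf u }) classOf-unique (classOf u ≟F j)

  cross? : ∀ r → Decidable (Cross P r)
  cross? r t = (∣ t ∣ ≟ℕ r) ×-dec all? λ j → all? λ u → all? λ v →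
    (u ∈? t) →-dec ((v ∈? t) →-dec (inPart? j u →-dec (inPart? j v →-dec (u ≟F v))))

-- A part j of 𝒫^(K) spans K distinct vertex classes: each of its edges meets each of
-- these classes exactly once.  For K ≥ 2 this comes from the polyad carrying the part.
record Spans {n : ℕ} (P : PData n) (K : ℕ) (j : Fin (m P K)) : Set where
  field
    class     : Fin K → Fin (m P 1)
    class-inj : ∀ a b → class a ≡ class b → a ≡ b
    meets     : ∀ e → e ∈ part P K j → ∀ l → MeetsOnce P (class l) e

module RainbowSets {n k : ℕ} (col : Fin n → Fin k) where

  record Rainbow (s : Subset n) : Set where
    field
      vertex     : Fin k → Fin n
      vertex∈    : ∀ i → vertex i ∈ₛ s
      vertex-col : ∀ i → col (vertex i) ≡ i
      size       : ∣ s ∣ ≡ k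

    vertex-inj : ∀ i j → vertex i ≡ vertex j → i ≡ j
    vertex-inj = injective-via col vertex (λ i → i) vertex-col (λ _ _ i≡j → i≡j)

    member-vertex : ∀ {u} → u ∈ₛ s → u ≡ vertex (col u)
    member-vertex {u} u∈s with exhaust k s vertex vertex-inj vertex∈ size u u∈s
    ... | i , refl = cong vertex (sym (vertex-col i))

    colour-unique : ∀ {u u′} → u ∈ₛ s → u′ ∈ₛ s → col u ≡ col u′ → u ≡ u′
    colour-unique {u} {u′} u∈s u′∈s same = begin
      u                ≡⟨ member-vertex u∈s ⟩
      vertex (col u)   ≡⟨ cong vertex same ⟩
      vertex (col u′)  ≡⟨ sym (member-vertex u′∈s) ⟩
      u′               ∎
      where open ≡-Reasoning

module Decomposition {n K : ℕ} (col : Fin n → Fin (suc K)) (P : PData n)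
  (L1 : IsPartition (λ s → ∣ s ∣ ≡ 1) (m P 1) (part P 1)) (ref : Refines P col)
  (LK : IsPartition (Cross P K) (m P K) (part P K)) (spans : ∀ j → Spans P K j) where

  open Classes P L1
  open RainbowSets col

  edge-size : ∀ {j e} → e ∈ part P K j → ∣ e ∣ ≡ K
  edge-size {j} e∈j = proj₁ (parts⊆ LK j e∈j)

  spans-cover : ∀ {j e u} → e ∈ part P K j → u ∈ₛ e → Σ (Fin K) λ l → InPart P (Spans.class (spans j) l) u
  spans-cover {j} {e} {u} e∈j u∈e =
    let (l , u≡hit) = exhaust K e hit hit-inj hit∈ (edge-size e∈j) u u∈e
    in l , subst (InPart P (class l)) (sym u≡hit) (hit-class l)
    where
    open Spans (spans j)
    hit : Fin K → Fin n
    hit l = proj₁ (meets e e∈j l)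
    hit∈ : ∀ l → hit l ∈ₛ e
    hit∈ l = proj₁ (proj₂ (meets e e∈j l))
    hit-class : ∀ l → InPart P (class l) (hit l)
    hit-class l = proj₁ (proj₂ (proj₂ (meets e e∈j l)))
    hit-inj : ∀ a b → hit a ≡ hit b → a ≡ b
    hit-inj = injective-via classOf hit class (λ l → classOf-unique (hit-class l)) class-inj

  module RainbowPolyad {s : Subset n} (R : Rainbow s) where
    open Rainbow R

    class-unique : ∀ {j u u′} → u ∈ₛ s → u′ ∈ₛ s → InPart P j u → InPart P j u′ → u ≡ u′
    class-unique u∈s u′∈s u∈j u′∈j = colour-unique u∈s u′∈s (ref _ _ _ u∈j u′∈j)

    facet-cross : ∀ i → Cross P K (s - vertex i)
    facet-cross i = suc-injective (trans (sym (size-remove s (vertex i) (vertex∈ i))) size)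
                  , λ j u u′ u∈ u′∈ → class-unique (proj₁ (∈-remove⁻ u∈)) (proj₁ (∈-remove⁻ u′∈))

    class : Fin (suc K) → Fin (m P 1)
    class i = classOf (vertex i)

    face : Fin (suc K) → Fin (m P K)
    face i = proj₁ (cover LK (s - vertex i) (facet-cross i))

    facet∈face : ∀ i → s - vertex i ∈ part P K (face i)
    facet∈face i = proj₂ (cover LK (s - vertex i) (facet-cross i))

    class-inj : ∀ i j → class i ≡ class j → i ≡ j
    class-inj i j same = vertex-inj i j
      (class-unique (vertex∈ i) (vertex∈ j) (inClassOf (vertex i))
                    (subst (λ c → InPart P c (vertex j)) (sym same) (inClassOf (vertex j))))

    -- An edge of face i meets each other class once (the classes spanned by face i are
    -- those of the vertices of s - vertex i) ...
    face-meets : ∀ i e → e ∈ part P K (face i) → ∀ j → j ≢ i → MeetsOnce P (class j) e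
    face-meets i e e∈ j j≢i with spans-cover (facet∈face i) (x∈p∧x≢y⇒x∈p-y (vertex∈ j) (j≢i ∘ vertex-inj j i))
    ... | l , vj∈l = subst (λ c → MeetsOnce P c e) (sym (classOf-unique vj∈l)) (Spans.meets (spans (face i)) e e∈ l)

    -- ... and avoids class i, which would otherwise contain two vertices of s.
    face-avoids : ∀ i e → e ∈ part P K (face i) → ∀ u → u ∈ₛ e → ¬ InPart P (class i) u
    face-avoids i e e∈ u u∈e u∈i with spans-cover e∈ u∈e
    ... | l , u∈l with Spans.meets (spans (face i)) (s - vertex i) (facet∈face i) l
    ... | y , y∈facet , y∈l , _ =
      let (y∈s , y≢vi) = ∈-remove⁻ y∈facet
          y∈i = subst (λ c → InPart P c y) (disjoint L1 _ _ u∈l u∈i) y∈l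
      in y≢vi (class-unique y∈s (vertex∈ i) y∈i (inClassOf (vertex i)))

    polyad : Polyad P (suc K)
    polyad = record { W = class ; W-inj = class-inj ; F = face
                    ; F-on = λ i e e∈ → face-meets i e e∈ , face-avoids i e e∈ }

    ∈𝒦 : s ∈ 𝒦 P polyad
    ∈𝒦 = size
       , (λ j → vertex j , vertex∈ j , inClassOf (vertex j)
              , λ u u∈s u∈j → class-unique u∈s (vertex∈ j) u∈j (inClassOf (vertex j)))
       , λ i u u∈s u∈i → subst (λ z → s - z ∈ part P K (face i))
                           (sym (class-unique u∈s (vertex∈ i) u∈i (inClassOf (vertex i)))) (facet∈face i)

    aligned : ∀ i u → InPart P (class i) u → col u ≡ i
    aligned i u u∈i = trans (ref _ u (vertex i) u∈i (inClassOf (vertex i))) (vertex-col i)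

  Aligned : Polyad P (suc K) → Set
  Aligned Q = ∀ i u → InPart P (W Q i) u → col u ≡ i

  shape : Polyad P (suc K) → Fin (suc K) → Fin (m P 1) × Fin (m P K)
  shape Q i = W Q i , F Q i

  SameShape : Polyad P (suc K) → Polyad P (suc K) → Set
  SameShape Q Q′ = ∀ i → shape Q i ≡ shape Q′ i

  shape-𝒦 : ∀ {Q Q′} → SameShape Q Q′ → 𝒦 P Q ⊆ 𝒦 P Q′
  shape-𝒦 same {t} (size , meets , faces) =
      size
    , (λ j → subst (λ c → MeetsOnce P c t) (cong proj₁ (same j)) (meets j))
    , λ i u u∈t u∈i → subst (λ c → t - u ∈ part P K c) (cong proj₂ (same i))
                        (faces i u u∈t (subst (λ c → InPart P c u) (sym (cong proj₁ (same i))) u∈i))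

  𝒦-rainbow : ∀ {Q t} → Aligned Q → t ∈ 𝒦 P Q → Rainbow t
  𝒦-rainbow al (size , meets , _) = record
    { vertex = λ i → proj₁ (meets i)
    ; vertex∈ = λ i → proj₁ (proj₂ (meets i))
    ; vertex-col = λ i → al i _ (proj₁ (proj₂ (proj₂ (meets i))))
    ; size = size }

  -- An aligned polyad is determined, up to shape, by any single k-set of its 𝒦: the i-th
  -- class is the class of the vertex of colour i, the i-th face contains the facet opposite it.
  shape-unique : ∀ {Q Q′ t} → Aligned Q → Aligned Q′ → t ∈ 𝒦 P Q → t ∈ 𝒦 P Q′ → SameShape Q Q′
  shape-unique {Q} {Q′} {t} al al′ t∈Q@(_ , meets , faces) (_ , meets′ , faces′) i
    with meets i | meets′ i
  ... | v , v∈t , v∈Qi , _ | u , u∈t , u∈Q′i , _ =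
    cong₂ _,_ (disjoint L1 _ _ u∈Qi u∈Q′i) (disjoint LK _ _ (faces i u u∈t u∈Qi) (faces′ i u u∈t u∈Q′i))
    where
    u≡v : u ≡ v
    u≡v = Rainbow.colour-unique (𝒦-rainbow {Q} al t∈Q) u∈t v∈t (trans (al′ i u u∈Q′i) (sym (al i v v∈Qi)))
    u∈Qi : InPart P (W Q i) u
    u∈Qi = subst (InPart P (W Q i)) (sym u≡v) v∈Qi

  module Cone (f : Fin (m P K))
    (transversal : ∀ e → e ∈ part P K f → ∀ (i : Fin (suc K)) → toℕ i < K →
                     Σ (Fin n) λ v → v ∈ₛ e × col v ≡ i × (∀ u → u ∈ₛ e → col u ≡ i → u ≡ v))
    (w : Fin (m P 1)) (w-colour : ∀ v → InPart P w v → toℕ (col v) ≡ K) where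

    Cone : Pred (Subset n) 0ℓ
    Cone = Comp P (suc K) f w

    edge-colour< : ∀ {e u} → e ∈ part P K f → u ∈ₛ e → toℕ (col u) < K
    edge-colour< {e} {u} e∈f u∈e =
      let (l , u≡corner) = exhaust K e corner corner-inj corner∈ (edge-size e∈f) u u∈e
      in subst (_< K) (cong toℕ (sym (trans (cong col u≡corner) (corner-col l)))) (inject₁ℕ< l)
      where
      corner : Fin K → Fin n
      corner l = proj₁ (transversal e e∈f (inject₁ l) (inject₁ℕ< l))
      corner∈ : ∀ l → corner l ∈ₛ e
      corner∈ l = proj₁ (proj₂ (transversal e e∈f (inject₁ l) (inject₁ℕ< l)))
      corner-col : ∀ l → col (corner l) ≡ inject₁ l
      corner-col l = proj₁ (proj₂ (proj₂ (transversal e e∈f (inject₁ l) (inject₁ℕ< l))))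
      corner-inj : ∀ a b → corner a ≡ corner b → a ≡ b
      corner-inj = injective-via col corner inject₁ corner-col (λ _ _ → inject₁-injective)

    apex∉edge : ∀ {e v} → e ∈ part P K f → InPart P w v → v ∉ₛ e
    apex∉edge e∈f v∈w v∈e = <-irrefl (w-colour _ v∈w) (edge-colour< e∈f v∈e)

    module ConeSet {e v} (e∈f : e ∈ part P K f) (v∈w : InPart P w v) where

      apex∈ : v ∈ₛ e ∪ ⁅ v ⁆
      apex∈ = x∈p∪q⁺ (inj₂ (x∈⁅x⁆ v))

      remove-apex : (e ∪ ⁅ v ⁆) - v ≡ e
      remove-apex = add-remove e v (apex∉edge e∈f v∈w)

      vertex : Fin (suc K) → Fin n
      vertex i with toℕ i <? K
      ... | yes i<K = proj₁ (transversal e e∈f i i<K)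
      ... | no _ = v

      vertex∈ : ∀ i → vertex i ∈ₛ e ∪ ⁅ v ⁆
      vertex∈ i with toℕ i <? K
      ... | yes i<K = x∈p∪q⁺ (inj₁ (proj₁ (proj₂ (transversal e e∈f i i<K))))
      ... | no _ = apex∈

      vertex-col : ∀ i → col (vertex i) ≡ i
      vertex-col i with toℕ i <? K
      ... | yes i<K = proj₁ (proj₂ (proj₂ (transversal e e∈f i i<K)))
      ... | no i≮K = toℕ-injective (trans (w-colour v v∈w) (≤-antisym (≮⇒≥ i≮K) (≤-pred (toℕ<n i))))

      apex-vertex : ∀ i → toℕ i ≡ K → vertex i ≡ v
      apex-vertex i i≡K with toℕ i <? K
      ... | yes i<K = contradiction i<K (<-irrefl i≡K)
      ... | no _ = refl

      rainbow : Rainbow (e ∪ ⁅ v ⁆)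
      rainbow = record
        { vertex = vertex ; vertex∈ = vertex∈ ; vertex-col = vertex-col
        ; size = trans (size-remove _ v apex∈) (cong suc (trans (cong ∣_∣ remove-apex) (edge-size e∈f))) }

      open RainbowPolyad rainbow using (polyad; facet∈face)

      last-class : ∀ i → toℕ i ≡ K → W polyad i ≡ w
      last-class i i≡K = trans (cong classOf (apex-vertex i i≡K)) (classOf-unique v∈w)

      last-face : ∀ i → toℕ i ≡ K → F polyad i ≡ f
      last-face i i≡K = disjoint LK _ _ (facet∈face i)
        (subst (_∈ part P K f) (sym (trans (cong (_ -_) (apex-vertex i i≡K)) remove-apex)) e∈f)

    𝒦⊆cone : ∀ Q → W Q (fromℕ K) ≡ w → F Q (fromℕ K) ≡ f → 𝒦 P Q ⊆ Cone
    𝒦⊆cone Q last-W last-F {t} (_ , meets , faces) with meets (fromℕ K)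
    ... | y , y∈t , y∈last , _ =
      t - y , y , subst (λ c → t - y ∈ part P K c) last-F (faces (fromℕ K) y y∈t y∈last)
            , subst (λ c → InPart P c y) last-W y∈last , sym (remove-add t y y∈t)

    cone? : Decidable Cone
    cone? s = map′ from to (any? λ v → (v ∈? s) ×-dec (inPart? w v ×-dec part? LK (cross? K) f (s - v)))
      where
      from : (∃ λ v → v ∈ₛ s × InPart P w v × s - v ∈ part P K f) → s ∈ Cone
      from (v , v∈s , v∈w , s-v∈f) = s - v , v , s-v∈f , v∈w , sym (remove-add s v v∈s)
      to : s ∈ Cone → ∃ λ v → v ∈ₛ s × InPart P w v × s - v ∈ part P K f
      to (e , v , e∈f , v∈w , refl) =
        v , ConeSet.apex∈ e∈f v∈w , v∈w , subst (_∈ part P K f) (sym (ConeSet.remove-apex e∈f v∈w)) e∈f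

    ConeElement : Set
    ConeElement = Σ (Subset n) Cone

    polyadOf : ConeElement → Polyad P (suc K)
    polyadOf (_ , _ , _ , e∈f , v∈w , _) = RainbowPolyad.polyad (ConeSet.rainbow e∈f v∈w)

    ∈𝒦-polyadOf : ∀ c → proj₁ c ∈ 𝒦 P (polyadOf c)
    ∈𝒦-polyadOf (_ , _ , _ , e∈f , v∈w , refl) = RainbowPolyad.∈𝒦 (ConeSet.rainbow e∈f v∈w)

    polyadOf-aligned : ∀ c → Aligned (polyadOf c)
    polyadOf-aligned (_ , _ , _ , e∈f , v∈w , _) = RainbowPolyad.aligned (ConeSet.rainbow e∈f v∈w)

    polyadOf-last-class : ∀ c i → toℕ i ≡ K → W (polyadOf c) i ≡ w
    polyadOf-last-class (_ , _ , _ , e∈f , v∈w , _) = ConeSet.last-class e∈f v∈w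

    polyadOf-last-face : ∀ c i → toℕ i ≡ K → F (polyadOf c) i ≡ f
    polyadOf-last-face (_ , _ , _ , e∈f , v∈w , _) = ConeSet.last-face e∈f v∈w

    byShape : DecSetoid 0ℓ 0ℓ
    byShape = On.decSetoid (Pointwise.decSetoid (≡-decSetoid (≡-dec _≟F_ _≟F_)) (suc K)) (shape ∘ polyadOf)

    decomposition : Σ ℕ λ N → Σ (Fin N → Polyad P (suc K)) λ Q →
                      (∀ a (i : Fin (suc K)) → toℕ i ≡ K → F (Q a) i ≡ f)
                      × (∀ s → (s ∈ Cone) ⇔ (Σ (Fin N) λ a → s ∈ 𝒦 P (Q a)))
                      × (∀ a b → a ≢ b → ∀ s → ¬ (s ∈ 𝒦 P (Q a) × s ∈ 𝒦 P (Q b)))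
                      × (∀ a → Satisfiable (𝒦 P (Q a)))
    decomposition =
      let (L , listed) = witnesses cone?
          (N , rep , represented , distinct) = Representatives.representatives byShape L
          Q = polyadOf ∘ rep
          into : ∀ s → s ∈ Cone → Σ (Fin N) λ a → s ∈ 𝒦 P (Q a)
          into s s∈ = let (c , c∈L) = listed s s∈
                          (a , same) = represented c∈L
                      in a , shape-𝒦 {polyadOf (s , c)} {Q a} same (∈𝒦-polyadOf (s , c))
          outof : ∀ s → (Σ (Fin N) λ a → s ∈ 𝒦 P (Q a)) → s ∈ Cone
          outof s (a , s∈) = 𝒦⊆cone (Q a) (polyadOf-last-class (rep a) (fromℕ K) (toℕ-fromℕ K))
                                    (polyadOf-last-face (rep a) (fromℕ K) (toℕ-fromℕ K)) s∈
      in N , Q , (polyadOf-last-face ∘ rep) , (λ s → mk⇔ (into s) (outof s))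
           , (λ a b a≢b s (s∈a , s∈b) → a≢b (distinct a b
                (shape-unique {Q a} {Q b} (polyadOf-aligned (rep a)) (polyadOf-aligned (rep b)) s∈a s∈b)))
           , λ a → proj₁ (rep a) , ∈𝒦-polyadOf (rep a)

-- For k = 2 the level 𝒫^(k-1) is the vertex partition itself: a partition of Cross_1
-- into sets of singletons, part j spanning the single class j.
module VertexLevel {n : ℕ} (P : PData n) (L1 : IsPartition (λ s → ∣ s ∣ ≡ 1) (m P 1) (part P 1)) where

  cross : IsPartition (Cross P 1) (m P 1) (part P 1)
  cross = record
    { parts⊆ = λ j s∈j → let size = parts⊆ L1 j s∈j in
                 size , λ _ u v u∈s v∈s _ _ → size-one-unique size u∈s v∈s
    ; nonempty = nonempty L1
    ; cover = λ s s∈ → cover L1 s (proj₁ s∈)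
    ; disjoint = disjoint L1 }

  spans : ∀ j → Spans P 1 j
  spans j = record { class = λ _ → j ; class-inj = λ { zero zero _ → refl }
                   ; meets = λ { e e∈j zero → meets-once e e∈j } }
    where
    meets-once : ∀ e → e ∈ part P 1 j → MeetsOnce P j e
    meets-once e e∈j with parts⊆ L1 j e∈j
    ... | size with size-pos-nonempty e size
    ... | v , v∈e = v , v∈e , subst (_∈ part P 1 j) (size-one-singleton size v∈e) e∈j
                  , λ u u∈e _ → size-one-unique size u∈e v∈e

polyad-spans : ∀ {n K} (P : PData n) j → (Σ (Polyad P K) λ Q → part P K j ⊆ 𝒦 P Q) → Spans P K j
polyad-spans P j (Q , j⊆𝒦Q) = record
  { class = W Q ; class-inj = W-inj Q ; meets = λ e e∈j → proj₁ (proj₂ (j⊆𝒦Q e∈j)) }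

claim4 : (k n : ℕ) → 2 ≤ k → (col : Fin n → Fin k) → (P : PData n) →
    IsKPartition P (k ∸ 1) → Refines P col →
    (f : Fin (m P (k ∸ 1))) →
    (∀ e → e ∈ part P (k ∸ 1) f → ∀ (i : Fin k) → toℕ i < k ∸ 1 →
    Σ (Fin n) λ v → v ∈ₛ e × col v ≡ i × (∀ u → u ∈ₛ e → col u ≡ i → u ≡ v)) →
    (w : Fin (m P 1)) → (∀ v → InPart P w v → toℕ (col v) ≡ k ∸ 1) →
    Σ ℕ λ N → Σ (Fin N → Polyad P k) λ Q →
    (∀ a (i : Fin k) → toℕ i ≡ k ∸ 1 → F (Q a) i ≡ f)
    × (∀ s → (s ∈ Comp P k f w) ⇔ (Σ (Fin N) λ a → s ∈ 𝒦 P (Q a)))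
    × (∀ a b → a ≢ b → ∀ s → ¬ (s ∈ 𝒦 P (Q a) × s ∈ 𝒦 P (Q b)))
    × (∀ a → Satisfiable (𝒦 P (Q a)))
claim4 zero _ () _ _ _ _ _ _ _ _
claim4 (suc zero) _ (s≤s ()) _ _ _ _ _ _ _ _
claim4 (suc (suc zero)) n _ col P 𝒫 ref f transversal w w-colour =
  Decomposition.Cone.decomposition col P L1 ref (VertexLevel.cross P L1) (VertexLevel.spans P L1)
    f transversal w w-colour
  where L1 = IsKPartition.level1 𝒫
claim4 (suc (suc (suc K))) n _ col P 𝒫 ref f transversal w w-colour =
  Decomposition.Cone.decomposition col P (IsKPartition.level1 𝒫) ref (proj₁ level)
    (λ j → polyad-spans P j (proj₂ level j)) f transversal w w-colour
  where level = IsKPartition.levelr 𝒫 (suc (suc K)) (s≤s (s≤s z≤n)) ≤-refl
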